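{- For any program $P$, the $\sqsubseteq$-least $\sqsupseteq^{\mathbf{4}}$-model of $P$ is $\mathrm{lfp}(\Phi_P)$, the least fixed point of $\Phi_P$ with respect to the information ordering.
   Context: Programs: atoms are $p(t_1,\ldots,t_n)$ over a fixed first-order alphabet, with a distinguished binary equality predicate $=$. A literal is an atom $A$ or its negation $\neg A$; a conjunction is a conjunction of literals; a disjunction is $C_1\lor\cdots\lor C_k$ ($k>0$) with each $C_i$ a conjunction. A predicate definition is a pair $(H,\exists W[D])$ where $H=p(V_1,\ldots,V_n)$ with distinct variables $V_i$, $D$ is a disjunction, and $W=\mathrm{vars}(D)\setminus\mathrm{vars}(H)$. A program is a finite set of predicate definitions with pairwise distinct head predicate symbols. A head grounding of a definition is an instance in which only the head variables are replaced by terms, so that the head becomes ground. $\mathcal{G}$ is the set of ground atoms. Truth values $\mathbf{4}=\{\mathbf{u},\mathbf{f},\mathbf{t},\mathbf{i}\}$ with information order $\sqsubseteq$: $\mathbf{u}\sqsubseteq x\sqsubseteq\mathbf{i}$ for all $x$, $x\sqsubseteq x$, $\mathbf{f},\mathbf{t}$ incomparable. Interpretations: pairs $I=(T_I,F_I)$ of subsets of $\mathcal{G}$, where a ground equality atom $s=s'$ lies in $T_I$ (and not $F_I$) if $s,s'$ are identical and in $F_I$ (and not $T_I$) otherwise. $I$ makes a ground atom $A$ true iff $A\in T_I$, false iff $A\in F_I$; $\neg A$ true iff $A\in F_I$, false iff $A\in T_I$; a ground conjunction true iff all conjuncts true, false iff some conjunct false; a ground disjunction true iff some disjunct true, false iff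 all false; $\exists W[D]$ true iff some ground instance of $D$ is made true, false iff all ground instances are made false. $I(F)$ is $\mathbf{u}$ (neither), $\mathbf{f}$ (false only), $\mathbf{t}$ (true only), $\mathbf{i}$ (both). Interpretations ordered pointwise: $I\sqsubseteq J$ iff $T_I\subseteq T_J$ and $F_I\subseteq F_J$; this is a complete lattice. $\Phi_P(I)$ is the interpretation in which every ground non-equality atom $A$ has value $I(B)$, where $(A,B)$ is the head grounding with head $A$ of the definition in $P$ of $A$'s predicate (all non-equality predicates are taken to be defined in $P$); equality atoms keep their fixed values. $\Phi_P$ is monotone with respect to $\sqsubseteq$. $I$ is a $\sqsupseteq^{\mathbf{4}}$-model of $P$ if $I(H)\sqsupseteq I(B)$ for every head grounding $(H,B)$ of every definition of $P$. -}

module Defs where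

open import Data.Nat using (ℕ)
open import Data.Fin using (Fin)
open import Data.Vec using (Vec; []; _∷_; lookup)
open import Data.List using (List; [])
open import Data.List.Relation.Unary.All using (All)
open import Data.List.Relation.Unary.Any using (Any)
open import Data.Maybe using (Maybe; just; nothing; _>>=_)
import Data.Maybe as Maybe
open import Data.Product using (Σ; _×_)
open import Relation.Binary.PropositionalEquality using (_≡_; _≢_)
open import Relation.Nullary using (¬_)

-- Equality is the distinguished extra binary predicate (constructor _≐_).
record Alphabet : Set₁ where
  field
    FunSym    : Set
    funArity  : FunSym → ℕ
    nPred     : ℕ
    predArity : Fin nPred → ℕ

module _ (𝔄 : Alphabet) where
  open Alphabet 𝔄

  data Term : Set where
    var : ℕ → Term
    fun : (f : FunSym) → Vec Term (funArity f) → Term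

  data GTerm : Set where
    gfun : (f : FunSym) → Vec GTerm (funArity f) → GTerm

  data Atom : Set where
    _≐_ : Term → Term → Atom
    app : (p : Fin nPred) → Vec Term (predArity p) → Atom

  data Literal : Set where
    pos : Atom → Literal
    neg : Atom → Literal

  litAtom : Literal → Atom
  litAtom (pos a) = a
  litAtom (neg a) = a

  Conjunction : Set
  Conjunction = List Literal

  Disjunction : Set
  Disjunction = List Conjunction

  -- predicate definition (p(V₁,…,Vₙ), ∃W[D]) with distinct head variables;
  -- W = vars(D) ∖ vars(H) is implicit (all non-head variables of D are
  -- existentially quantified in the semantics below).
  record Definition (p : Fin nPred) : Set where
    field
      headVars     : Vec ℕ (predArity p)
      headDistinct : ∀ i j → lookup headVars i ≡ lookup headVars j → i ≡ j
      body         : Disjunction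
      bodyNonEmpty : body ≢ []

  Program : Set
  Program = (p : Fin nPred) → Definition p

  Assignment : Set
  Assignment = ℕ → Maybe GTerm

  evalT  : Assignment → Term → Maybe GTerm
  evalTs : ∀ {n} → Assignment → Vec Term n → Maybe (Vec GTerm n)
  evalT σ (var x) = σ x
  evalT σ (fun f ts) = Maybe.map (gfun f) (evalTs σ ts)
  evalTs σ [] = just []
  evalTs σ (t ∷ ts) = evalT σ t >>= λ g → Maybe.map (g ∷_) (evalTs σ ts)

  Defined : {A : Set} → Maybe A → Set
  Defined {A} m = Σ A λ a → m ≡ just a

  AtomGround : Assignment → Atom → Set
  AtomGround σ (s ≐ s') = Defined (evalT σ s) × Defined (evalT σ s')
  AtomGround σ (app p ts) = Defined (evalTs σ ts)

  Grounds : Assignment → Disjunction → Set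
  Grounds σ D = All (All (λ l → AtomGround σ (litAtom l))) D

  -- interpretations (T_I, F_I) restricted to non-equality ground atoms;
  -- ground equality atoms have their fixed values (built into atomT/atomF)
  record Interp : Set₁ where
    field
      T : (p : Fin nPred) → Vec GTerm (predArity p) → Set
      F : (p : Fin nPred) → Vec GTerm (predArity p) → Set
  open Interp public

  atomT atomF : Interp → Assignment → Atom → Set
  atomT I σ (s ≐ s') = Σ GTerm λ g → Σ GTerm λ g' →
    evalT σ s ≡ just g × evalT σ s' ≡ just g' × g ≡ g'
  atomT I σ (app p ts) = Σ (Vec GTerm (predArity p)) λ gs →
    evalTs σ ts ≡ just gs × T I p gs
  atomF I σ (s ≐ s') = Σ GTerm λ g → Σ GTerm λ g' →
    evalT σ s ≡ just g × evalT σ s' ≡ just g' × ¬ (g ≡ g')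
  atomF I σ (app p ts) = Σ (Vec GTerm (predArity p)) λ gs →
    evalTs σ ts ≡ just gs × F I p gs

  litT litF : Interp → Assignment → Literal → Set
  litT I σ (pos a) = atomT I σ a
  litT I σ (neg a) = atomF I σ a
  litF I σ (pos a) = atomF I σ a
  litF I σ (neg a) = atomT I σ a

  conjT conjF : Interp → Assignment → Conjunction → Set
  conjT I σ c = All (litT I σ) c
  conjF I σ c = Any (litF I σ) c

  disjT disjF : Interp → Assignment → Disjunction → Set
  disjT I σ D = Any (conjT I σ) D
  disjF I σ D = All (conjF I σ) D

  Agrees : ∀ {p} → Definition p → Assignment → Vec GTerm (predArity p) → Set
  Agrees d σ gs = ∀ i → σ (lookup (Definition.headVars d) i) ≡ just (lookup gs i)

  bodyT bodyF : Interp → ∀ {p} → Definition p → Vec GTerm (predArity p) → Set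
  bodyT I d gs = Σ Assignment λ σ →
    Grounds σ (Definition.body d) × Agrees d σ gs × disjT I σ (Definition.body d)
  bodyF I d gs = ∀ (σ : Assignment) →
    Grounds σ (Definition.body d) → Agrees d σ gs → disjF I σ (Definition.body d)

  Φ : Program → Interp → Interp
  T (Φ P I) p gs = bodyT I (P p) gs
  F (Φ P I) p gs = bodyF I (P p) gs

  _⊑_ : Interp → Interp → Set
  I ⊑ J = (∀ p gs → T I p gs → T J p gs) × (∀ p gs → F I p gs → F J p gs)

  -- I(H) ⊒ I(B) for every head grounding (H,B): in 𝟒 this means
  -- (B true ⇒ H true) and (B false ⇒ H false)
  IsModel4 : Program → Interp → Set
  IsModel4 P I = ∀ p gs →
    (bodyT I (P p) gs → T I p gs) × (bodyF I (P p) gs → F I p gs)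

  -- fixed point (up to extensional equality of T and F)
  IsFixedPoint : Program → Interp → Set
  IsFixedPoint P I = (Φ P I ⊑ I) × (I ⊑ Φ P I)

  IsLeast : (Interp → Set) → Interp → Set₁
  IsLeast R I = R I × (∀ J → R J → I ⊑ J)

-- The least fixed point of Φ_P is defined directly as an inductive family:
-- a ground atom is true (false) in it exactly when its body is made true
-- (false) by it.  This is legitimate because the truth and falsity sets occur
-- only positively in the body semantics.  It is then a fixed point by
-- construction, and structural recursion on its derivations is Park induction:
-- it lies below every interpretation J with Φ_P(J) ⊑ J.  Such J are exactly
-- the ⊒⁴-models, and fixed points are in particular models, so the least
-- fixed point is also the least model.
module Submission where

open import Defs
open import Data.Bool using (Bool; true; false)
open import Data.Fin using (Fin)
open import Data.Vec using (Vec)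
open import Data.List.Relation.Unary.All using ([]; _∷_)
open import Data.List.Relation.Unary.Any using (here; there)
open import Data.Product using (Σ; _×_; _,_; proj₁; proj₂)
open import Function using (_∘_)

module _ {𝔄 : Alphabet} where
  open Alphabet 𝔄

  ⊑-trans : ∀ {I J K} → _⊑_ 𝔄 I J → _⊑_ 𝔄 J K → _⊑_ 𝔄 I K
  ⊑-trans (IJᵀ , IJᶠ) (JKᵀ , JKᶠ) =
    (λ p gs → JKᵀ p gs ∘ IJᵀ p gs) , (λ p gs → JKᶠ p gs ∘ IJᶠ p gs)

  module _ {P : Program 𝔄} where

    model⇒prefixed : ∀ {J} → IsModel4 𝔄 P J → _⊑_ 𝔄 (Φ 𝔄 P J) J
    model⇒prefixed m = (λ p gs → proj₁ (m p gs)) , (λ p gs → proj₂ (m p gs))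

    prefixed⇒model : ∀ {J} → _⊑_ 𝔄 (Φ 𝔄 P J) J → IsModel4 𝔄 P J
    prefixed⇒model (Φᵀ , Φᶠ) p gs = Φᵀ p gs , Φᶠ p gs

    fixedPoint⇒model : ∀ {J} → IsFixedPoint 𝔄 P J → IsModel4 𝔄 P J
    fixedPoint⇒model fp = prefixed⇒model (proj₁ fp)

  data Lfp (P : Program 𝔄) : Bool → (p : Fin nPred) → Vec (GTerm 𝔄) (predArity p) → Set where
    true⁺  : ∀ {p gs} → bodyT 𝔄 (record { T = Lfp P true ; F = Lfp P false }) (P p) gs → Lfp P true p gs
    false⁺ : ∀ {p gs} → bodyF 𝔄 (record { T = Lfp P true ; F = Lfp P false }) (P p) gs → Lfp P false p gs

  lfp : Program 𝔄 → Interp 𝔄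
  lfp P = record { T = Lfp P true ; F = Lfp P false }

  module _ {P : Program 𝔄} where

    lfp-isFixedPoint : IsFixedPoint 𝔄 P (lfp P)
    lfp-isFixedPoint = ((λ _ _ → true⁺) , (λ _ _ → false⁺))
                     , ((λ { _ _ (true⁺ b) → b }) , (λ { _ _ (false⁺ b) → b }))

    -- The traversal of the body semantics has to be spelled out (rather than
    -- obtained from a generic monotonicity lemma) so that recursion on Lfp is
    -- visibly structural.
    module Park {J : Interp 𝔄} (prefixed : _⊑_ 𝔄 (Φ 𝔄 P J) J) where
      mutual
        lfp⊑ᵀ : ∀ {p gs} → Lfp P true p gs → T J p gs
        lfp⊑ᵀ {p} {gs} (true⁺ (σ , grounds , agrees , d)) =
          proj₁ prefixed p gs (σ , grounds , agrees , disjT-lfp⊑ d)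

        lfp⊑ᶠ : ∀ {p gs} → Lfp P false p gs → F J p gs
        lfp⊑ᶠ {p} {gs} (false⁺ b) =
          proj₂ prefixed p gs (λ σ grounds agrees → disjF-lfp⊑ (b σ grounds agrees))

        atomT-lfp⊑ : ∀ {σ} a → atomT 𝔄 (lfp P) σ a → atomT 𝔄 J σ a
        atomT-lfp⊑ (_ ≐ _)    eq           = eq
        atomT-lfp⊑ (app _ _) (gs , e , t) = gs , e , lfp⊑ᵀ t

        atomF-lfp⊑ : ∀ {σ} a → atomF 𝔄 (lfp P) σ a → atomF 𝔄 J σ a
        atomF-lfp⊑ (_ ≐ _)    neq          = neq
        atomF-lfp⊑ (app _ _) (gs , e , f) = gs , e , lfp⊑ᶠ f

        litT-lfp⊑ : ∀ {σ} l → litT 𝔄 (lfp P) σ l → litT 𝔄 J σ l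
        litT-lfp⊑ (pos a) = atomT-lfp⊑ a
        litT-lfp⊑ (neg a) = atomF-lfp⊑ a

        litF-lfp⊑ : ∀ {σ} l → litF 𝔄 (lfp P) σ l → litF 𝔄 J σ l
        litF-lfp⊑ (pos a) = atomF-lfp⊑ a
        litF-lfp⊑ (neg a) = atomT-lfp⊑ a

        conjT-lfp⊑ : ∀ {σ c} → conjT 𝔄 (lfp P) σ c → conjT 𝔄 J σ c
        conjT-lfp⊑ []             = []
        conjT-lfp⊑ (_∷_ {l} t ts) = litT-lfp⊑ l t ∷ conjT-lfp⊑ ts

        conjF-lfp⊑ : ∀ {σ c} → conjF 𝔄 (lfp P) σ c → conjF 𝔄 J σ c
        conjF-lfp⊑ (here {l} f) = here (litF-lfp⊑ l f)
        conjF-lfp⊑ (there f)    = there (conjF-lfp⊑ f)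

        disjT-lfp⊑ : ∀ {σ D} → disjT 𝔄 (lfp P) σ D → disjT 𝔄 J σ D
        disjT-lfp⊑ (here t)  = here (conjT-lfp⊑ t)
        disjT-lfp⊑ (there t) = there (disjT-lfp⊑ t)

        disjF-lfp⊑ : ∀ {σ D} → disjF 𝔄 (lfp P) σ D → disjF 𝔄 J σ D
        disjF-lfp⊑ []       = []
        disjF-lfp⊑ (f ∷ fs) = conjF-lfp⊑ f ∷ disjF-lfp⊑ fs

    lfp-least-prefixed : ∀ {J} → _⊑_ 𝔄 (Φ 𝔄 P J) J → _⊑_ 𝔄 (lfp P) J
    lfp-least-prefixed prefixed = (λ _ _ → lfp⊑ᵀ) , (λ _ _ → lfp⊑ᶠ)
      where open Park prefixed

    lfp-isLeastFixedPoint : IsLeast 𝔄 (IsFixedPoint 𝔄 P) (lfp P)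
    lfp-isLeastFixedPoint =
      lfp-isFixedPoint , λ _ fp → lfp-least-prefixed (proj₁ fp)

    leastFixedPoint⇒leastModel : ∀ {I} → IsLeast 𝔄 (IsFixedPoint 𝔄 P) I →
                                 IsLeast 𝔄 (IsModel4 𝔄 P) I
    leastFixedPoint⇒leastModel (fp , least) =
        fixedPoint⇒model {P = P} fp
      , λ J model → ⊑-trans (least (lfp P) lfp-isFixedPoint)
                            (lfp-least-prefixed (model⇒prefixed {P = P} model))

proposition6p2 : (𝔄 : Alphabet) (P : Program 𝔄) →
    Σ (Interp 𝔄) (IsLeast 𝔄 (IsFixedPoint 𝔄 P)) ×
    (∀ I → IsLeast 𝔄 (IsFixedPoint 𝔄 P) I → IsLeast 𝔄 (IsModel4 𝔄 P) I)
proposition6p2 𝔄 P = (lfp P , lfp-isLeastFixedPoint)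
                   , λ _ → leastFixedPoint⇒leastModel {P = P}
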